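{- Let $wa$ be a pv-string with $a\in\Sigma\cup\mathcal{N}$, $x=\mathsf{LRS}(wa)$, $y=\max[x]^R_w$, and suppose $x\neq y$. Then for every node $u$ and symbol $b$: (i) $(u,b,[y]^R_{wa})\in E_{wa}$ if and only if $(u,b,[y]^R_w)\in E_w$ and $|\max u|+1>|x|$; (ii) $(u,b,[x]^R_{wa})\in E_{wa}$ if and only if $b=\mathsf{Z}(a,|\max u|)$, $(u,b,[y]^R_w)\in E_w$ and $|\max u|+1\le|x|$.
   Context: $\Sigma$ (static), $\Pi$ (parameter) disjoint alphabets; $\mathcal{N}$ non-negative integers. $\mathsf{prev}(S)[i]=S[i]$ if $S[i]\in\Sigma$; $=0$ if $S[i]\in\Pi$ does not occur in $S[1:i-1]$; $=i-j$ if $j<i$ is the last earlier position with $S[j]=S[i]\in\Pi$; pv-strings are strings $\mathsf{prev}(S)$. $\mathsf{Z}(a,j)=0$ if $a\in\mathcal{N}$, $a>j$, else $a$; $\langle x\rangle[i]=\mathsf{Z}(x[i],i-1)$. For a pv-string $w$: $\mathsf{PFactor}(w)$, $\mathsf{PSuffix}(w)$ are the re-encodings of factors/suffixes of $w$; $\mathsf{RPos}_w(x)=\{i\in\{0..|w|\}: x=\langle w[i-|x|+1:i]\rangle\}$; $[x]^R_w$ the class of $x$ under equality of $\mathsf{RPos}_w$, and for a class $u$, $\max u$ its longest element. $\mathsf{PDAWG}(w)=(V_w,E_w)$ with $V_w=\{[x]^R_w: x\in\mathsf{PFactor}(w)\}$, $E_w=\{([x]^R_w,c,[z]^R_w): z=\max[x]^R_w\cdot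 c\}$. $\mathsf{LRS}(wa)$ is the longest element of $\mathsf{PSuffix}(wa)\cap\mathsf{PFactor}(w)$. -}

module Defs where

open import Data.Nat using (ℕ; zero; suc; _+_; _∸_; _≤_; _<_; _<ᵇ_)
open import Data.Bool using (if_then_else_)
open import Data.List using (List; []; _∷_; _++_; [_]; length; take; drop)
open import Data.Maybe using (Maybe; just; nothing)
open import Data.Sum using (_⊎_; inj₁; inj₂)
open import Data.Product using (Σ; _×_; ∃; _,_)
open import Relation.Nullary using (yes; no)
open import Relation.Binary.Definitions using (DecidableEquality)
open import Relation.Binary.PropositionalEquality using (_≡_)
open import Function.Bundles using (_⇔_)

data Sym (S : Set) : Set where
  stat : S → Sym S
  num  : ℕ → Sym S

module _ {S P : Set} (_≟_ : DecidableEquality P) where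

  -- distance to the last occurrence of p in a *reversed* prefix
  lastDist : P → List (S ⊎ P) → Maybe ℕ
  lastDist p [] = nothing
  lastDist p (inj₁ _ ∷ rs) = Data.Maybe.map suc (lastDist p rs)
  lastDist p (inj₂ q ∷ rs) with q ≟ p
  ... | yes _ = just 1
  ... | no _  = Data.Maybe.map suc (lastDist p rs)

  encode : List (S ⊎ P) → S ⊎ P → Sym S
  encode rev (inj₁ s) = stat s
  encode rev (inj₂ p) with lastDist p rev
  ... | nothing = num 0
  ... | just d  = num d

  prevAux : List (S ⊎ P) → List (S ⊎ P) → List (Sym S)
  prevAux rev [] = []
  prevAux rev (c ∷ cs) = encode rev c ∷ prevAux (c ∷ rev) cs

  prev : List (S ⊎ P) → List (Sym S)
  prev = prevAux []

  IsPV : List (Sym S) → Set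
  IsPV w = ∃ λ (T : List (S ⊎ P)) → prev T ≡ w

module _ {S : Set} where

  Z : Sym S → ℕ → Sym S
  Z (stat s) j = stat s
  Z (num n) j = if j <ᵇ n then num 0 else num n

  reencAux : ℕ → List (Sym S) → List (Sym S)
  reencAux k [] = []
  reencAux k (c ∷ cs) = Z c k ∷ reencAux (suc k) cs

  -- ⟨x⟩ with ⟨x⟩[i] = Z(x[i], i-1)  (1-indexed)
  ⟨_⟩ : List (Sym S) → List (Sym S)
  ⟨ x ⟩ = reencAux 0 x

  -- i ∈ RPos_w(x) : i ∈ {0..|w|}, |x| ≤ i, and x = ⟨w[i-|x|+1 : i]⟩
  RPos : List (Sym S) → List (Sym S) → ℕ → Set
  RPos w x i = length x ≤ i × i ≤ length w × ⟨ take (length x) (drop (i ∸ length x) w) ⟩ ≡ x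

  PFactor : List (Sym S) → List (Sym S) → Set
  PFactor w x = ∃ λ i → RPos w x i

  PSuffix : List (Sym S) → List (Sym S) → Set
  PSuffix w x = RPos w x (length w)

  Cls : List (Sym S) → List (Sym S) → List (Sym S) → Set
  Cls w x z = PFactor w z × (∀ i → RPos w z i ⇔ RPos w x i)

  _≐_ : (List (Sym S) → Set) → (List (Sym S) → Set) → Set
  U ≐ V = ∀ z → U z ⇔ V z

  IsMaxOf : (List (Sym S) → Set) → List (Sym S) → Set
  IsMaxOf U m = U m × (∀ m' → U m' → length m' ≤ length m)

  Node : List (Sym S) → (List (Sym S) → Set) → Set
  Node w U = ∃ λ x → PFactor w x × U ≐ Cls w x

  Edge : List (Sym S) → (List (Sym S) → Set) → Sym S → (List (Sym S) → Set) → Set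
  Edge w U c V = ∃ λ x → ∃ λ m →
    PFactor w x × U ≐ Cls w x × IsMaxOf (Cls w x) m ×
    PFactor w (m ++ [ c ]) × V ≐ Cls w (m ++ [ c ])

  IsLRS : List (Sym S) → Sym S → List (Sym S) → Set
  IsLRS w a x = PSuffix (w ++ [ a ]) x × PFactor w x ×
    (∀ x' → PSuffix (w ++ [ a ]) x' → PFactor w x' → length x' ≤ length x)

-- Appending a to w creates exactly one new end position, |wa|, and it belongs to the
-- occurrences of the suffixes of wa. The suffixes of wa that occur in w are the
-- re-encoded suffixes of x, so the only class of PDAWG(w) that changes is [x]_w,
-- which splits into [x]_wa (the elements of length ≤ |x|, which gain |wa|) and
-- [y]_wa (the longer ones, which do not). Every other class, in particular the class
-- of the source m of an edge m·b into [x]_w, keeps its elements and end positions; m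
-- is never in [x]_w, since otherwise every occurrence of m would extend to one of m·b.
-- Hence an edge into [x]_w is redirected to [x]_wa or [y]_wa according as |m·b| ≤ |x|.
module Submission where

open import Defs
open import Data.Nat using (ℕ; zero; suc; _+_; _∸_; _≤_; _<_; _<ᵇ_; z≤n; s≤s; s≤s⁻¹; _≤?_)
open import Data.Nat.Properties
open import Data.Bool as Bool using (true; false)
open import Data.Unit using (tt)
open import Data.Empty using (⊥; ⊥-elim)
open import Data.List using (List; []; _∷_; _++_; [_]; length; take; drop)
open import Data.List.Properties
  using ( take-drop; drop-drop; take-all; length-drop; length-++-≤ˡ
        ; ∷-injectiveˡ; ∷-injectiveʳ; ∷ʳ-injective )
open import Data.Product using (_×_; ∃; _,_; proj₁; proj₂)
open import Data.Sum using (_⊎_; inj₁; inj₂)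
open import Relation.Nullary using (¬_; Dec; yes; no)
open import Relation.Binary.Definitions using (DecidableEquality)
open import Relation.Binary.PropositionalEquality
  using (_≡_; _≢_; refl; sym; trans; cong; cong₂; subst; module ≡-Reasoning)
open import Function using (_∘_)
open import Function.Bundles using (_⇔_; mk⇔; module Equivalence)
import Function.Properties.Equivalence as ⇔

open Equivalence using (to; from)

private
  variable
    A S : Set
    i : ℕ
    V V₁ V₂ z z₁ z₂ z₃ m : List (Sym S)
    b c : Sym S
    U U′ U″ T : List (Sym S) → Set

take-++ˡ : (n : ℕ) (xs ys : List A) → n ≤ length xs → take n (xs ++ ys) ≡ take n xs
take-++ˡ zero    xs       ys _         = refl
take-++ˡ (suc n) (x ∷ xs) ys (s≤s n≤) = cong (x ∷_) (take-++ˡ n xs ys n≤)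

drop-++ˡ : (n : ℕ) (xs ys : List A) → n ≤ length xs → drop n (xs ++ ys) ≡ drop n xs ++ ys
drop-++ˡ zero    xs       ys _         = refl
drop-++ˡ (suc n) (x ∷ xs) ys (s≤s n≤) = drop-++ˡ n xs ys n≤

length-snoc : (xs : List A) (y : A) → length (xs ++ [ y ]) ≡ suc (length xs)
length-snoc []       y = refl
length-snoc (x ∷ xs) y = cong suc (length-snoc xs y)

[i∸L]+j≡i∸[L∸j] : (i L j : ℕ) → j ≤ L → L ≤ i → (i ∸ L) + j ≡ i ∸ (L ∸ j)
[i∸L]+j≡i∸[L∸j] i L j j≤L L≤i = begin
  (i ∸ L) + j                       ≡⟨ m+n∸n≡m ((i ∸ L) + j) (L ∸ j) ⟨
  (i ∸ L) + j + (L ∸ j) ∸ (L ∸ j)   ≡⟨ cong (_∸ (L ∸ j)) i≡ ⟩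
  i ∸ (L ∸ j)                       ∎
  where
  open ≡-Reasoning
  i≡ : (i ∸ L) + j + (L ∸ j) ≡ i
  i≡ = begin
    (i ∸ L) + j + (L ∸ j)   ≡⟨ +-assoc (i ∸ L) j (L ∸ j) ⟩
    (i ∸ L) + (j + (L ∸ j)) ≡⟨ cong ((i ∸ L) +_) (m+[n∸m]≡n j≤L) ⟩
    (i ∸ L) + L             ≡⟨ m∸n+n≡m L≤i ⟩
    i                       ∎

window : List A → ℕ → ℕ → List A
window V i L = take L (drop (i ∸ L) V)

window≡drop-take : (V : List A) {i L : ℕ} → L ≤ i → window V i L ≡ drop (i ∸ L) (take i V)
window≡drop-take V {i} {L} L≤i =
  trans (take-drop L (i ∸ L) V) (cong (λ k → drop (i ∸ L) (take k V)) (m∸n+n≡m L≤i))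

drop-window : (V : List A) {i L : ℕ} (j : ℕ) → j ≤ L → L ≤ i →
              drop j (window V i L) ≡ window V i (L ∸ j)
drop-window V {i} {L} j j≤L L≤i = begin
  drop j (window V i L)              ≡⟨ cong (drop j) (window≡drop-take V L≤i) ⟩
  drop j (drop (i ∸ L) (take i V))   ≡⟨ drop-drop (i ∸ L) j (take i V) ⟩
  drop (i ∸ L + j) (take i V)
    ≡⟨ cong (λ k → drop k (take i V)) ([i∸L]+j≡i∸[L∸j] i L j j≤L L≤i) ⟩
  drop (i ∸ (L ∸ j)) (take i V)      ≡⟨ window≡drop-take V (≤-trans (m∸n≤m L j) L≤i) ⟨
  window V i (L ∸ j)                 ∎
  where open ≡-Reasoning

window-++ : (V₁ V₂ : List A) {i L : ℕ} → L ≤ i → i ≤ length V₁ →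
            window (V₁ ++ V₂) i L ≡ window V₁ i L
window-++ V₁ V₂ {i} {L} L≤i i≤ = begin
  window (V₁ ++ V₂) i L              ≡⟨ window≡drop-take (V₁ ++ V₂) L≤i ⟩
  drop (i ∸ L) (take i (V₁ ++ V₂))   ≡⟨ cong (drop (i ∸ L)) (take-++ˡ i V₁ V₂ i≤) ⟩
  drop (i ∸ L) (take i V₁)           ≡⟨ window≡drop-take V₁ L≤i ⟨
  window V₁ i L                      ∎
  where open ≡-Reasoning

window-snoc-end : (V : List A) (c : A) {L : ℕ} → L ≤ length V →
                  window (V ++ [ c ]) (suc (length V)) (suc L) ≡ window V (length V) L ++ [ c ]
window-snoc-end V c {L} L≤ = begin
  window (V ++ [ c ]) (suc n) (suc L)          ≡⟨ window≡drop-take (V ++ [ c ]) (s≤s L≤) ⟩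
  drop (n ∸ L) (take (suc n) (V ++ [ c ]))
    ≡⟨ cong (drop (n ∸ L)) (take-all (suc n) (V ++ [ c ]) (≤-reflexive (length-snoc V c))) ⟩
  drop (n ∸ L) (V ++ [ c ])                    ≡⟨ drop-++ˡ (n ∸ L) V [ c ] (m∸n≤m n L) ⟩
  drop (n ∸ L) V ++ [ c ]
    ≡⟨ cong (λ t → drop (n ∸ L) t ++ [ c ]) (take-all n V ≤-refl) ⟨
  drop (n ∸ L) (take n V) ++ [ c ]             ≡⟨ cong (_++ [ c ]) (window≡drop-take V L≤) ⟨
  window V n L ++ [ c ]                        ∎
  where
  open ≡-Reasoning
  n = length V

Z-Z : (c : Sym S) {k l : ℕ} → k ≤ l → Z (Z c l) k ≡ Z c k
Z-Z (stat s) _ = refl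
Z-Z (num n) {k} {l} k≤l with l <ᵇ n in l<n
... | false = refl
... | true with k <ᵇ n | <⇒<ᵇ (≤-<-trans k≤l (<ᵇ⇒< l n (subst Bool.T (sym l<n) tt)))
...   | true  | _ = refl
...   | false | ()

length-reencAux : (k : ℕ) (s : List (Sym S)) → length (reencAux k s) ≡ length s
length-reencAux k []      = refl
length-reencAux k (c ∷ s) = cong suc (length-reencAux (suc k) s)

drop-reencAux : (j k : ℕ) (s : List (Sym S)) → drop j (reencAux k s) ≡ reencAux (j + k) (drop j s)
drop-reencAux zero    k s       = refl
drop-reencAux (suc j) k []      = refl
drop-reencAux (suc j) k (c ∷ s) =
  trans (drop-reencAux j (suc k) s) (cong (λ q → reencAux q (drop j s)) (+-suc j k))

reencAux-reencAux : {k l : ℕ} → k ≤ l → (s : List (Sym S)) →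
                    reencAux k (reencAux l s) ≡ reencAux k s
reencAux-reencAux k≤l []      = refl
reencAux-reencAux k≤l (c ∷ s) = cong₂ _∷_ (Z-Z c k≤l) (reencAux-reencAux (s≤s k≤l) s)

⟨drop⟨⟩⟩ : (j : ℕ) (s : List (Sym S)) → ⟨ drop j ⟨ s ⟩ ⟩ ≡ ⟨ drop j s ⟩
⟨drop⟨⟩⟩ j s = trans (cong ⟨_⟩ (drop-reencAux j 0 s)) (reencAux-reencAux z≤n (drop j s))

reencAux-snoc : (r : ℕ) (s : List (Sym S)) (c : Sym S) →
                reencAux r (s ++ [ c ]) ≡ reencAux r s ++ [ Z c (length s + r) ]
reencAux-snoc r []      c = refl
reencAux-snoc r (d ∷ s) c =
  cong (Z d r ∷_) (trans (reencAux-snoc (suc r) s c)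
                         (cong (λ k → reencAux (suc r) s ++ [ Z c k ]) (+-suc (length s) r)))

reencAux-take-init : (r : ℕ) (m t : List (Sym S)) (b : Sym S) →
                     reencAux r (take (suc (length m)) t) ≡ m ++ [ b ] →
                     reencAux r (take (length m) t) ≡ m
reencAux-take-init r []      t       b e = refl
reencAux-take-init r (c ∷ m) []      b ()
reencAux-take-init r (c ∷ m) (d ∷ t) b e =
  cong₂ _∷_ (∷-injectiveˡ e) (reencAux-take-init (suc r) m t b (∷-injectiveʳ e))

RPos-bound : RPos V z i → i ≤ length V
RPos-bound (_ , i≤ , _) = i≤

RPos-suffix : (j : ℕ) → j ≤ length z → RPos V z i → RPos V ⟨ drop j z ⟩ i
RPos-suffix {z = z} {V = V} {i = i} j j≤ (L≤i , i≤ , e) =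
  subst (_≤ i) (sym len) (≤-trans (m∸n≤m L j) L≤i) , i≤ , eq
  where
  open ≡-Reasoning
  L = length z
  len : length ⟨ drop j z ⟩ ≡ L ∸ j
  len = trans (length-reencAux 0 (drop j z)) (length-drop j z)
  eq : ⟨ window V i (length ⟨ drop j z ⟩) ⟩ ≡ ⟨ drop j z ⟩
  eq rewrite len = begin
    ⟨ window V i (L ∸ j) ⟩         ≡⟨ cong ⟨_⟩ (drop-window V j j≤ L≤i) ⟨
    ⟨ drop j (window V i L) ⟩      ≡⟨ ⟨drop⟨⟩⟩ j (window V i L) ⟨
    ⟨ drop j ⟨ window V i L ⟩ ⟩    ≡⟨ cong (λ t → ⟨ drop j t ⟩) e ⟩
    ⟨ drop j z ⟩                   ∎

RPos-unique : RPos V z₁ i → RPos V z₂ i → length z₁ ≡ length z₂ → z₁ ≡ z₂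
RPos-unique {V = V} {i = i} {z₂ = z₂} (_ , _ , e₁) (_ , _ , e₂) eq =
  trans (sym e₁) (subst (λ L → ⟨ window V i L ⟩ ≡ z₂) (sym eq) e₂)

-- A shorter string ending where a longer one ends is a re-encoded suffix of it.
RPos-⊆-at-common-end : RPos V z₂ i → RPos V z₁ i → length z₁ ≤ length z₂ →
                       ∀ j → RPos V z₂ j → RPos V z₁ j
RPos-⊆-at-common-end {V = V} {z₂ = z₂} {z₁ = z₁} r₂ r₁ ≤z₂ j r₂j =
  subst (λ q → RPos V q j) suffix≡z₁ (RPos-suffix d d≤ r₂j)
  where
  d = length z₂ ∸ length z₁
  d≤ = m∸n≤m (length z₂) (length z₁)
  suffix≡z₁ : ⟨ drop d z₂ ⟩ ≡ z₁
  suffix≡z₁ = RPos-unique (RPos-suffix d d≤ r₂) r₁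
    (trans (length-reencAux 0 (drop d z₂)) (trans (length-drop d z₂) (m∸[m∸n]≡n ≤z₂)))

RPos-init : RPos V (m ++ [ b ]) (suc i) → RPos V m i
RPos-init {V = V} {m = m} {b = b} {i = i} r rewrite length-snoc m b with r
... | (L≤i , i≤ , e) =
  s≤s⁻¹ L≤i , ≤-trans (n≤1+n i) i≤ , reencAux-take-init 0 m (drop (i ∸ length m) V) b e

PFactor-init : PFactor V (m ++ [ b ]) → PFactor V m
PFactor-init {m = m} {b = b} (zero , L≤0 , _) with () ← subst (_≤ 0) (length-snoc m b) L≤0
PFactor-init (suc i , r) = i , RPos-init r

-- By descent: every occurrence of m would end one position after another one.
¬extends-everywhere : PFactor V m → ¬ (∀ i → RPos V m i → RPos V (m ++ [ b ]) i)
¬extends-everywhere {V = V} {m = m} {b = b} (i , r) extends = descend i r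
  where
  descend : ∀ i → RPos V m i → ⊥
  descend zero    r with () ← subst (_≤ 0) (length-snoc m b) (proj₁ (extends zero r))
  descend (suc i) r = descend i (RPos-init (extends (suc i) r))

RPos-++⁺ : RPos V₁ z i → RPos (V₁ ++ V₂) z i
RPos-++⁺ {V₁ = V₁} {V₂ = V₂} (L≤i , i≤ , e) =
  L≤i , ≤-trans i≤ (length-++-≤ˡ V₁) , trans (cong ⟨_⟩ (window-++ V₁ V₂ L≤i i≤)) e

PFactor-++⁺ : PFactor V₁ z → PFactor (V₁ ++ V₂) z
PFactor-++⁺ (i , r) = i , RPos-++⁺ r

RPos-++⁻ : i ≤ length V₁ → RPos (V₁ ++ V₂) z i → RPos V₁ z i
RPos-++⁻ {V₁ = V₁} {V₂ = V₂} i≤ (L≤i , _ , e) =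
  L≤i , i≤ , trans (cong ⟨_⟩ (sym (window-++ V₁ V₂ L≤i i≤))) e

last-of-PSuffix : {w : List (Sym S)} {a : Sym S} →
                  PSuffix (w ++ [ a ]) (m ++ [ b ]) → b ≡ Z a (length m)
last-of-PSuffix {m = m} {b = b} {w = w} {a = a} r rewrite length-snoc m b | length-snoc w a with r
... | (L≤ , _ , e) = trans (sym (proj₂ split)) (cong (Z a) (trans (+-identityʳ (length s)) |s|≡|m|))
  where
  s = window w (length w) (length m)
  split : ⟨ s ⟩ ≡ m × Z a (length s + 0) ≡ b
  split = ∷ʳ-injective ⟨ s ⟩ m
    (trans (sym (reencAux-snoc 0 s a)) (trans (cong ⟨_⟩ (sym (window-snoc-end w a (s≤s⁻¹ L≤)))) e))
  |s|≡|m| : length s ≡ length m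
  |s|≡|m| = trans (sym (length-reencAux 0 s)) (cong length (proj₁ split))

SameRPos : List (Sym S) → List (Sym S) → List (Sym S) → Set
SameRPos V z₁ z₂ = ∀ i → RPos V z₁ i ⇔ RPos V z₂ i

SameRPos-sym : SameRPos V z₁ z₂ → SameRPos V z₂ z₁
SameRPos-sym e i = ⇔.sym (e i)

SameRPos-trans : SameRPos V z₁ z₂ → SameRPos V z₂ z₃ → SameRPos V z₁ z₃
SameRPos-trans e f i = ⇔.trans (e i) (f i)

PFactor-transport : SameRPos V z₁ z₂ → PFactor V z₂ → PFactor V z₁
PFactor-transport e (i , r) = i , from (e i) r

≐-sym : U ≐ U′ → U′ ≐ U
≐-sym e z = ⇔.sym (e z)

≐-trans : U ≐ U′ → U′ ≐ U″ → U ≐ U″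
≐-trans e f z = ⇔.trans (e z) (f z)

Cls-cong : SameRPos V z₁ z₂ → Cls V z₁ ≐ Cls V z₂
Cls-cong e z = mk⇔ (λ (occ , same) → occ , SameRPos-trans same e)
                   (λ (occ , same) → occ , SameRPos-trans same (SameRPos-sym e))

SameRPos-of-Cls≐ : PFactor V z₁ → Cls V z₁ ≐ Cls V z₂ → SameRPos V z₁ z₂
SameRPos-of-Cls≐ {z₁ = z₁} occ e = proj₂ (to (e z₁) (occ , λ i → ⇔.refl))

IsMaxOf-cong : U ≐ U′ → IsMaxOf U m → IsMaxOf U′ m
IsMaxOf-cong {m = m} e (m∈ , longest) =
  to (e m) m∈ , λ m′ m′∈ → longest m′ (from (e m′) m′∈)

-- Edge with the representative of the source fixed to its longest element m.
EdgeAt : List (Sym S) → (List (Sym S) → Set) → Sym S → (List (Sym S) → Set) → List (Sym S) → Set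
EdgeAt V U c T m = U ≐ Cls V m × IsMaxOf U m × PFactor V (m ++ [ c ]) × T ≐ Cls V (m ++ [ c ])

Edge⇔EdgeAt : Edge V U c T ⇔ ∃ (EdgeAt V U c T)
Edge⇔EdgeAt = mk⇔
  (λ (_ , m , _ , U≐ , max-m , occ , T≐) →
     m , ≐-trans U≐ (Cls-cong (SameRPos-sym (proj₂ (proj₁ max-m)))) ,
     IsMaxOf-cong (≐-sym U≐) max-m , occ , T≐)
  (λ (m , U≐ , max-m , occ , T≐) →
     m , m , proj₁ (to (U≐ m) (proj₁ max-m)) , U≐ , IsMaxOf-cong U≐ max-m , occ , T≐)

module _ {w : List (Sym S)} {a : Sym S} where

  RPos-snoc-cases : RPos (w ++ [ a ]) z i → RPos w z i ⊎ i ≡ length (w ++ [ a ])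
  RPos-snoc-cases {i = i} r with i ≤? length w
  ... | yes i≤ = inj₁ (RPos-++⁻ i≤ r)
  ... | no  i≰ = inj₂ (≤-antisym (RPos-bound r) (subst (_≤ i) (sym (length-snoc w a)) (≰⇒> i≰)))

  SameRPos-snoc : SameRPos (w ++ [ a ]) z₁ z₂ ⇔
                  (SameRPos w z₁ z₂ × (PSuffix (w ++ [ a ]) z₁ ⇔ PSuffix (w ++ [ a ]) z₂))
  SameRPos-snoc = mk⇔
    (λ e → (λ i → mk⇔ (restrict (to ∘ e) i) (restrict (from ∘ e) i)) , e (length (w ++ [ a ])))
    (λ (e , s) i → mk⇔ (extend (to ∘ e) (to s) i) (extend (from ∘ e) (from s) i))
    where
    restrict : (∀ i → RPos (w ++ [ a ]) z₁ i → RPos (w ++ [ a ]) z₂ i) →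
               ∀ i → RPos w z₁ i → RPos w z₂ i
    restrict f i r = RPos-++⁻ (RPos-bound r) (f i (RPos-++⁺ r))
    extend : (∀ i → RPos w z₁ i → RPos w z₂ i) →
             (PSuffix (w ++ [ a ]) z₁ → PSuffix (w ++ [ a ]) z₂) →
             ∀ i → RPos (w ++ [ a ]) z₁ i → RPos (w ++ [ a ]) z₂ i
    extend f s i r with RPos-snoc-cases r
    ... | inj₁ r′  = RPos-++⁺ (f i r′)
    ... | inj₂ refl = s r

module LRS {w : List (Sym S)} {a : Sym S} {x : List (Sym S)} (lrs : IsLRS w a x) where

  private
    W = w ++ [ a ]
    x-suffix = proj₁ lrs
    i₀ = proj₁ (proj₁ (proj₂ lrs))
    x-at-i₀ = proj₂ (proj₁ (proj₂ lrs))
    x-occurs = proj₁ (proj₂ lrs)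
    x-longest = proj₂ (proj₂ lrs)

  PSuffix⇔≤LRS : SameRPos w z x → PSuffix W z ⇔ length z ≤ length x
  PSuffix⇔≤LRS {z = z} z~x = mk⇔
    (λ z-suffix → x-longest z z-suffix (PFactor-transport z~x x-occurs))
    (λ z≤x → RPos-⊆-at-common-end (RPos-++⁺ x-at-i₀) (RPos-++⁺ (from (z~x i₀) x-at-i₀)) z≤x
               (length W) x-suffix)

  RPos-LRS-⊆ : PSuffix W z → PFactor w z → ∀ i → RPos w x i → RPos w z i
  RPos-LRS-⊆ {z = z} z-suffix z-occurs i r =
    RPos-++⁻ (RPos-bound r)
      (RPos-⊆-at-common-end x-suffix z-suffix (x-longest z z-suffix z-occurs) i (RPos-++⁺ r))

  -- Every end position of x is one of m; were m longer than x, the converse would hold too.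
  PSuffix-invariant : PFactor w m → ¬ SameRPos w m x → SameRPos w z m → PSuffix W z → PSuffix W m
  PSuffix-invariant {m = m} m-occurs m≁x z~m z-suffix = by-length (length m ≤? length x)
    where
    x⊆m : ∀ i → RPos w x i → RPos w m i
    x⊆m i = to (z~m i) ∘ RPos-LRS-⊆ z-suffix (PFactor-transport z~m m-occurs) i
    m-at-i₀ = x⊆m i₀ x-at-i₀
    by-length : Dec (length m ≤ length x) → PSuffix W m
    by-length (yes m≤x) =
      RPos-⊆-at-common-end (RPos-++⁺ x-at-i₀) (RPos-++⁺ m-at-i₀) m≤x (length W) x-suffix
    by-length (no m≰x) = ⊥-elim (m≁x λ i →
      mk⇔ (RPos-⊆-at-common-end m-at-i₀ x-at-i₀ (<⇒≤ (≰⇒> m≰x)) i) (x⊆m i))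

  Cls-snoc : PFactor w m → ¬ SameRPos w m x → Cls W m ≐ Cls w m
  Cls-snoc m-occurs m≁x z = mk⇔
    (λ (_ , z~m) → let z~ʷm = proj₁ (to SameRPos-snoc z~m) in PFactor-transport z~ʷm m-occurs , z~ʷm)
    (λ (z-occurs , z~m) → PFactor-++⁺ z-occurs , from SameRPos-snoc (z~m , mk⇔
       (PSuffix-invariant m-occurs m≁x z~m)
       (PSuffix-invariant z-occurs (m≁x ∘ SameRPos-trans (SameRPos-sym z~m)) (SameRPos-sym z~m))))

  Cls-snoc-source : SameRPos w (m ++ [ b ]) x → Cls W m ≐ Cls w m
  Cls-snoc-source mb~x = Cls-snoc m-occurs
    (λ m~x → ¬extends-everywhere m-occurs λ i → from (mb~x i) ∘ to (m~x i))
    where m-occurs = PFactor-init (PFactor-transport mb~x x-occurs)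

  module Redirect {y : List (Sym S)} (max-y : IsMaxOf (Cls w x) y) (x≢y : x ≢ y) where

    private
      y-occurs = proj₁ (proj₁ max-y)
      y~x = proj₂ (proj₁ max-y)

    ¬PSuffix-y : ¬ PSuffix W y
    ¬PSuffix-y = <⇒≱ x<y ∘ to (PSuffix⇔≤LRS y~x)
      where
      x≤y = proj₂ max-y x (x-occurs , λ i → ⇔.refl)
      x<y = ≤∧≢⇒< x≤y λ |x|≡|y| → x≢y (RPos-unique x-at-i₀ (from (y~x i₀) x-at-i₀) |x|≡|y|)

    target-y~x : EdgeAt w U b (Cls w y) m → SameRPos w (m ++ [ b ]) x
    target-y~x (_ , _ , _ , y≐) = SameRPos-trans (SameRPos-sym (SameRPos-of-Cls≐ y-occurs y≐)) y~x

    EdgeAt-snoc⁻ : SameRPos w (m ++ [ b ]) x → EdgeAt W U b T m → EdgeAt w U b (Cls w y) m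
    EdgeAt-snoc⁻ mb~x (U≐ , max-m , _ , _) =
      ≐-trans U≐ (Cls-snoc-source mb~x) , max-m , PFactor-transport mb~x x-occurs ,
      Cls-cong (SameRPos-trans y~x (SameRPos-sym mb~x))

    EdgeAt-snoc⁺ : EdgeAt w U b (Cls w y) m → T ≐ Cls W (m ++ [ b ]) → EdgeAt W U b T m
    EdgeAt-snoc⁺ e@(U≐ , max-m , mb-occurs , _) T≐ =
      ≐-trans U≐ (≐-sym (Cls-snoc-source (target-y~x e))) , max-m , PFactor-++⁺ mb-occurs , T≐

    into-y⇒ : Edge W U b (Cls W y) →
              Edge w U b (Cls w y) × ∃ λ m → IsMaxOf U m × length x < suc (length m)
    into-y⇒ {b = b} e with m , e′@(_ , max-m , _ , y≐) ← to Edge⇔EdgeAt e =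
      from Edge⇔EdgeAt (m , EdgeAt-snoc⁻ mb~x e′) , m , max-m , x<mb
      where
      y~mb = to SameRPos-snoc (SameRPos-of-Cls≐ (PFactor-++⁺ y-occurs) y≐)
      mb~x = SameRPos-trans (SameRPos-sym (proj₁ y~mb)) y~x
      x<mb : length x < suc (length m)
      x<mb = subst (length x <_) (length-snoc m b)
        (≰⇒> λ mb≤x → ¬PSuffix-y (from (proj₂ y~mb) (from (PSuffix⇔≤LRS mb~x) mb≤x)))

    into-y⇐ : Edge w U b (Cls w y) × (∃ λ m → IsMaxOf U m × length x < suc (length m)) →
              Edge W U b (Cls W y)
    into-y⇐ {b = b} (e , m′ , max-m′ , x<m′) with m , e′@(_ , max-m , _ , _) ← to Edge⇔EdgeAt e =
      from Edge⇔EdgeAt (m , EdgeAt-snoc⁺ e′ (Cls-cong (from SameRPos-snoc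
        (SameRPos-trans y~x (SameRPos-sym mb~x) , mk⇔ (⊥-elim ∘ ¬PSuffix-y) (⊥-elim ∘ ¬mb-suffix)))))
      where
      mb~x = target-y~x e′
      x<mb : length x < length (m ++ [ b ])
      x<mb = subst (length x <_) (sym (length-snoc m b))
        (≤-trans x<m′ (s≤s (proj₂ max-m m′ (proj₁ max-m′))))
      ¬mb-suffix : ¬ PSuffix W (m ++ [ b ])
      ¬mb-suffix = <⇒≱ x<mb ∘ to (PSuffix⇔≤LRS mb~x)

    into-x⇒ : Edge W U b (Cls W x) →
              ∃ λ m → IsMaxOf U m × b ≡ Z a (length m) × Edge w U b (Cls w y) ×
                      suc (length m) ≤ length x
    into-x⇒ {b = b} e with m , e′@(_ , max-m , _ , x≐) ← to Edge⇔EdgeAt e =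
      m , max-m , last-of-PSuffix mb-suffix , from Edge⇔EdgeAt (m , EdgeAt-snoc⁻ mb~x e′) ,
      subst (_≤ length x) (length-snoc m b) (to (PSuffix⇔≤LRS mb~x) mb-suffix)
      where
      x~mb = to SameRPos-snoc (SameRPos-of-Cls≐ (PFactor-++⁺ x-occurs) x≐)
      mb~x = SameRPos-sym (proj₁ x~mb)
      mb-suffix = to (proj₂ x~mb) x-suffix

    into-x⇐ : (∃ λ m → IsMaxOf U m × b ≡ Z a (length m) × Edge w U b (Cls w y) ×
                       suc (length m) ≤ length x) →
              Edge W U b (Cls W x)
    into-x⇐ {b = b} (m′ , max-m′ , _ , e , m′<x) with m , e′@(_ , max-m , _ , _) ← to Edge⇔EdgeAt e =
      from Edge⇔EdgeAt (m , EdgeAt-snoc⁺ e′ (Cls-cong (from SameRPos-snoc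
        (SameRPos-sym mb~x , mk⇔ (λ _ → mb-suffix) (λ _ → x-suffix)))))
      where
      mb~x = target-y~x e′
      mb≤x : length (m ++ [ b ]) ≤ length x
      mb≤x = subst (_≤ length x) (sym (length-snoc m b))
        (≤-trans (s≤s (proj₂ max-m′ m (proj₁ max-m))) m′<x)
      mb-suffix = from (PSuffix⇔≤LRS mb~x) mb≤x

-- The argument never uses that wa is a pv-string.
lemma5 : {S P : Set} (_≟_ : DecidableEquality P)
    (w : List (Sym S)) (a : Sym S) (x y : List (Sym S)) →
    IsPV {S} _≟_ (w ++ [ a ]) →
    IsLRS w a x →
    IsMaxOf (Cls w x) y →
    x ≢ y →
    (U : List (Sym S) → Set) (b : Sym S) →
    (Edge (w ++ [ a ]) U b (Cls (w ++ [ a ]) y)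
    ⇔ (Edge w U b (Cls w y) × ∃ λ m → IsMaxOf U m × length x < suc (length m)))
    ×
    (Edge (w ++ [ a ]) U b (Cls (w ++ [ a ]) x)
    ⇔ (∃ λ m → IsMaxOf U m × b ≡ Z a (length m) × Edge w U b (Cls w y) × suc (length m) ≤ length x))
lemma5 _ w a x y _ lrs max-y x≢y U b =
  mk⇔ into-y⇒ into-y⇐ , mk⇔ into-x⇒ into-x⇐
  where open LRS.Redirect lrs max-y x≢y
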